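{- For every $k$, there exists an explicitly constructible coloring family $\mathcal F$ for cactus-grid graphs on the $k\times k$ table of size $2^{O(k\log\log k)}$.
   Context: A cactus-grid graph (on the $k\times k$ table) is a graph with vertex set $[k]\times[k]$ determined by a mapping $\delta:[k]\to[k]$, whose edge set consists exactly of: all edges between the vertices $(1,\delta(1)),\dots,(k,\delta(k))$ (a clique with one vertex from each row), and, for each $1\le i\le k$, the edges between $(i,\delta(i))$ and $(i,j)$ for all $j\ne\delta(i)$. A coloring family for cactus-grid graphs is a set $\mathcal F$ of functions $f:[k]\times[k]\to[k+1]$ such that for every cactus-grid graph $G$ on the $k\times k$ table there exists $f\in\mathcal F$ that is a proper coloring of $G$ (adjacent vertices receive different values). -}

module Defs where

open import Data.Nat using (ℕ; suc)
open import Data.Fin using (Fin)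
open import Data.Product using (_×_; Σ)
open import Data.Sum using (_⊎_)
open import Data.List using (List)
open import Data.List.Membership.Propositional using (_∈_)
open import Relation.Binary.PropositionalEquality using (_≡_; _≢_)

Cell : ℕ → Set
Cell k = Fin k × Fin k

CactusAdj : {k : ℕ} → (Fin k → Fin k) → Fin k → Fin k → Fin k → Fin k → Set
CactusAdj δ i j i' j' =
  (j ≡ δ i × j' ≡ δ i' × i ≢ i')
  ⊎ (i ≡ i' × ((j ≡ δ i × j' ≢ δ i) ⊎ (j' ≡ δ i × j ≢ δ i)))

ProperColoring : {k : ℕ} → (Fin k → Fin k) → (Fin k → Fin k → Fin (suc k)) → Set
ProperColoring δ f =
  ∀ i j i' j' → CactusAdj δ i j i' j' → f i j ≢ f i' j'

IsColoringFamily : (k : ℕ) → List (Fin k → Fin k → Fin (suc k)) → Set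
IsColoringFamily k F =
  ∀ (δ : Fin k → Fin k) → Σ (Fin k → Fin k → Fin (suc k)) (λ f → (f ∈ F) × ProperColoring δ f)

-- Colour the clique vertex (i , δ i) by the position of row i among the rows of δ⁻¹(δ i), shifted
-- so that different columns use disjoint intervals of colours below k. Every other vertex (i , j)
-- gets the colour that row i would receive inside the interval of column j (or k if column j holds
-- no clique vertex), hence differs from the colour of (i , δ i). The position of a row inside a
-- column is computed by a binary trie that splits on bits of the row index: a trie with s leaves is
-- written with 2s − 1 tokens from an alphabet of 3 + ⌊log₂ k⌋ letters, so each colouring is decoded
-- from a word of 3k such tokens, and there are (3 + ⌊log₂ k⌋)^(3k) = 2^O(k log log k) words.
module Submission where

open import Data.Bool using (Bool; true; false; if_then_else_; _≟_)
open import Data.Bool.Properties using (¬-not)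
open import Data.Empty using (⊥-elim)
open import Data.Fin as Fin using (Fin; toℕ; finToFun; funToFin)
open import Data.Fin.Properties
  using (toℕ-fromℕ; toℕ-fromℕ<; 2↔Bool; funToFin-finToFin; finToFun-funToFin; inject≤-injective)
open import Data.List using (List; []; _∷_; _++_; length; filter; map; allFin)
open import Data.List.Properties using (++-assoc; length-++; length-map; length-tabulate)
open import Data.List.Membership.Propositional using (_∈_)
open import Data.List.Membership.Propositional.Properties using (∈-filter⁺; ∈-map⁺; ∈-allFin)
open import Data.List.Relation.Unary.Any using (here; there)
open import Data.Maybe using (Maybe; just; nothing)
open import Data.Nat using (ℕ; zero; suc; _+_; _*_; _^_; _≤_; _<_; z≤n; s≤s)
open import Data.Nat.Logarithm using (⌊log₂_⌋; ⌊log₂⌋-mono-≤; ⌊log₂[2^n]⌋≡n)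
open import Data.Nat.Properties
  using ( module ≤-Reasoning; ≤-refl; ≤-reflexive; ≤-trans; <-≤-trans; <-irrefl; <⇒≤; <⇒≢; <⇒≱; ≰⇒>
        ; n≤1+n; m≤m+n; m≤n+m; +-suc; +-comm; +-assoc; +-identityʳ; +-mono-≤; +-monoʳ-≤; +-monoʳ-<
        ; +-cancelˡ-≡; *-monoʳ-≤; *-distribˡ-+; m⊓n≤n; m≤n⇒m⊓n≡m; ^-monoˡ-≤; ^-monoʳ-≤; ^-*-assoc
        ; +-0-commutativeMonoid; +-*-semiring )
open import Algebra.Properties.CommutativeMonoid.Sum +-0-commutativeMonoid
  using (sum; sum-syntax; sum-cong-≗; sum-replicate-zero; ∑-distrib-+)
open import Algebra.Properties.Semiring.Sum +-*-semiring using (*-distribˡ-sum)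
open import Data.Nat.Tactic.RingSolver using (solve-∀)
open import Data.Product using (Σ; ∃; _×_; _,_; proj₁; proj₂; map₁; map₂)
open import Data.Sum using (_⊎_; inj₁; inj₂)
open import Data.Vec as Vec using (Vec)
open import Data.Vec.Properties as Vec using ()
open import Defs
open import Function using (_∘_; id; Inverse)
open import Relation.Binary.PropositionalEquality
  using (_≡_; _≢_; _≗_; refl; sym; trans; cong; cong₂; subst; module ≡-Reasoning)
open import Relation.Nullary using (does)

data Trie (L : ℕ) : Set where
  leaf : Trie L
  node : Fin L → Trie L → Trie L → Trie L

leaves : ∀ {L} → Trie L → ℕ
leaves leaf         = 1
leaves (node _ l r) = leaves l + leaves r

module Splitting {A : Set} {L : ℕ} (test : Fin L → A → Bool) where

  slot : Trie L → A → ℕ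
  slot leaf         x = 0
  slot (node c l r) x = if test c x then leaves l + slot r x else slot l x

  slot<leaves : ∀ t x → slot t x < leaves t
  slot<leaves leaf         x = s≤s z≤n
  slot<leaves (node c l r) x with test c x
  ... | true  = +-monoʳ-< (leaves l) (slot<leaves r x)
  ... | false = ≤-trans (slot<leaves l x) (m≤m+n (leaves l) (leaves r))

  slot-node : ∀ {c l r x y} → slot (node c l r) x ≡ slot (node c l r) y →
              (test c x ≡ false × test c y ≡ false × slot l x ≡ slot l y)
              ⊎ (test c x ≡ true × test c y ≡ true × slot r x ≡ slot r y)
  slot-node {c} {l} {r} {x} {y} eq with test c x | test c y
  ... | false | false = inj₁ (refl , refl , eq)
  ... | true  | true  = inj₂ (refl , refl , +-cancelˡ-≡ (leaves l) _ _ eq)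
  ... | true  | false = ⊥-elim (<⇒≱ (slot<leaves l y) (≤-trans (m≤m+n _ _) (≤-reflexive eq)))
  ... | false | true  = ⊥-elim (<⇒≱ (slot<leaves l x) (≤-trans (m≤m+n _ _) (≤-reflexive (sym eq))))

  part : Fin L → Bool → List A → List A
  part c b = filter (λ x → test c x ≟ b)

  length-parts : ∀ c xs → length (part c false xs) + length (part c true xs) ≡ length xs
  length-parts c []       = refl
  length-parts c (x ∷ xs) with test c x
  ... | false = cong suc (length-parts c xs)
  ... | true  = trans (+-suc _ _) (cong suc (length-parts c xs))

  ∈-part : ∀ {c b x xs} → x ∈ xs → test c x ≡ b → x ∈ part c b xs
  ∈-part {c} {b} = ∈-filter⁺ (λ x → test c x ≟ b)

  part-[]⇒constant : ∀ {c b x y xs} → part c b xs ≡ [] → x ∈ xs → y ∈ xs → test c x ≡ test c y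
  part-[]⇒constant {c} {b} {x} {y} {xs} empty x∈ y∈ = trans (¬-not (avoids x∈)) (sym (¬-not (avoids y∈)))
    where
      avoids : ∀ {z} → z ∈ xs → test c z ≢ b
      avoids z∈ tz≡b with () ← subst (_ ∈_) empty (∈-part z∈ tz≡b)

  -- A test that is constant on the list is skipped, so both subtrees of every node are built from
  -- nonempty lists and the trie has at most as many leaves as the list has elements.
  build : List (Fin L) → List A → Trie L
  build []       xs = leaf
  build (c ∷ cs) xs with part c false xs | part c true xs
  ... | []     | _      = build cs xs
  ... | _ ∷ _  | []     = build cs xs
  ... | f ∷ fs | t ∷ ts = node c (build cs (f ∷ fs)) (build cs (t ∷ ts))

  leaves-build : ∀ cs x xs → leaves (build cs (x ∷ xs)) ≤ length (x ∷ xs)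
  leaves-build []       x xs = s≤s z≤n
  leaves-build (c ∷ cs) x xs with part c false (x ∷ xs) in ef | part c true (x ∷ xs) in et
  ... | []     | _      = leaves-build cs x xs
  ... | _ ∷ _  | []     = leaves-build cs x xs
  ... | f ∷ fs | t ∷ ts = begin
    leaves (build cs (f ∷ fs)) + leaves (build cs (t ∷ ts))         ≤⟨ +-mono-≤ (leaves-build cs f fs) (leaves-build cs t ts) ⟩
    length (f ∷ fs) + length (t ∷ ts)                               ≡⟨ cong₂ (λ p q → length p + length q) ef et ⟨
    length (part c false (x ∷ xs)) + length (part c true (x ∷ xs))  ≡⟨ length-parts c (x ∷ xs) ⟩
    length (x ∷ xs)                                                 ∎
    where open ≤-Reasoning

  build-separates : ∀ cs xs {x y} → x ∈ xs → y ∈ xs → slot (build cs xs) x ≡ slot (build cs xs) y →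
                    ∀ {c} → c ∈ cs → test c x ≡ test c y
  build-separates (c ∷ cs) xs x∈ y∈ eq c∈ with part c false xs in ef | part c true xs in et
  build-separates (c ∷ cs) xs x∈ y∈ eq (here refl) | [] | _ = part-[]⇒constant ef x∈ y∈
  build-separates (c ∷ cs) xs x∈ y∈ eq (there c∈) | [] | _ = build-separates cs xs x∈ y∈ eq c∈
  build-separates (c ∷ cs) xs x∈ y∈ eq (here refl) | _ ∷ _ | [] = part-[]⇒constant et x∈ y∈
  build-separates (c ∷ cs) xs x∈ y∈ eq (there c∈) | _ ∷ _ | [] = build-separates cs xs x∈ y∈ eq c∈
  build-separates (c ∷ cs) xs x∈ y∈ eq c′∈ | f ∷ fs | t ∷ ts
    with slot-node {c} {build cs (f ∷ fs)} {build cs (t ∷ ts)} eq | c′∈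
  ... | inj₁ (tx , ty , _)   | here refl = trans tx (sym ty)
  ... | inj₂ (tx , ty , _)   | here refl = trans tx (sym ty)
  ... | inj₁ (tx , ty , eq′) | there c∈ =
    build-separates cs (f ∷ fs) (subst (_ ∈_) ef (∈-part x∈ tx)) (subst (_ ∈_) ef (∈-part y∈ ty)) eq′ c∈
  ... | inj₂ (tx , ty , eq′) | there c∈ =
    build-separates cs (t ∷ ts) (subst (_ ∈_) et (∈-part x∈ tx)) (subst (_ ∈_) et (∈-part y∈ ty)) eq′ c∈

Token : ℕ → Set
Token L = Fin (suc (suc L))

pattern leaf-token   = Fin.zero
pattern empty-token  = Fin.suc Fin.zero
pattern node-token c = Fin.suc (Fin.suc c)

module _ {L : ℕ} where

  serialise : Trie L → List (Token L)
  serialise leaf         = leaf-token ∷ []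
  serialise (node c l r) = node-token c ∷ serialise l ++ serialise r

  -- The fuel only ensures termination; decodeTrie supplies the length of the input, which suffices.
  parseTrie : ℕ → List (Token L) → Trie L × List (Token L)
  parseTrie (suc n) (node-token c ∷ ts) =
    let l , ts′ = parseTrie n ts ; r , ts″ = parseTrie n ts′ in node c l r , ts″
  parseTrie _ (_ ∷ ts) = leaf , ts
  parseTrie _ []       = leaf , []

  parseTrie-serialise : ∀ n t rest → length (serialise t) ≤ n → parseTrie n (serialise t ++ rest) ≡ (t , rest)
  parseTrie-serialise (suc n) leaf rest _ = refl
  parseTrie-serialise (suc n) (node c l r) rest (s≤s len≤n)
    rewrite ++-assoc (serialise l) (serialise r) rest
          | length-++ (serialise l) {serialise r}
          | parseTrie-serialise n l (serialise r ++ rest) (≤-trans (m≤m+n _ _) len≤n)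
          | parseTrie-serialise n r rest (≤-trans (m≤n+m _ _) len≤n) = refl

  length-serialise : ∀ t → suc (length (serialise t)) ≡ 2 * leaves t
  length-serialise leaf = refl
  length-serialise (node c l r) = begin
    suc (suc (length (serialise l ++ serialise r)))            ≡⟨ cong (suc ∘ suc) (length-++ (serialise l)) ⟩
    suc (suc (length (serialise l) + length (serialise r)))    ≡⟨ cong suc (+-suc _ _) ⟨
    suc (length (serialise l)) + suc (length (serialise r))    ≡⟨ cong₂ _+_ (length-serialise l) (length-serialise r) ⟩
    2 * leaves l + 2 * leaves r                                ≡⟨ *-distribˡ-+ 2 (leaves l) (leaves r) ⟨
    2 * (leaves l + leaves r)                                  ∎
    where open ≡-Reasoning

  decodeTrie : List (Token L) → Trie L × List (Token L)
  decodeTrie ts = parseTrie (length ts) ts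

  decodeTrie-serialise : ∀ t rest → decodeTrie (serialise t ++ rest) ≡ (t , rest)
  decodeTrie-serialise t rest =
    parseTrie-serialise _ t rest (≤-trans (m≤m+n _ _) (≤-reflexive (sym (length-++ (serialise t)))))

  encodeColumn : Maybe (Trie L) → List (Token L)
  encodeColumn nothing  = empty-token ∷ []
  encodeColumn (just t) = serialise t

  decodeColumn : List (Token L) → Maybe (Trie L) × List (Token L)
  decodeColumn (empty-token ∷ ts) = nothing , ts
  decodeColumn ts                 = map₁ just (decodeTrie ts)

  decodeColumn-encodeColumn : ∀ c rest → decodeColumn (encodeColumn c ++ rest) ≡ (c , rest)
  decodeColumn-encodeColumn nothing               rest = refl
  decodeColumn-encodeColumn (just t@leaf)         rest = cong (map₁ just) (decodeTrie-serialise t rest)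
  decodeColumn-encodeColumn (just t@(node _ _ _)) rest = cong (map₁ just) (decodeTrie-serialise t rest)

module Concatenation {T B : Set} (encode : B → List T) (decode : List T → B × List T)
                     (decode-encode : ∀ b rest → decode (encode b ++ rest) ≡ (b , rest)) where

  encodeAll : ∀ {m} → (Fin m → B) → List T
  encodeAll {zero}  bs = []
  encodeAll {suc m} bs = encode (bs Fin.zero) ++ encodeAll (bs ∘ Fin.suc)

  decodeAll : ∀ {m} → List T → Fin m → B
  decodeAll ts Fin.zero    = proj₁ (decode ts)
  decodeAll ts (Fin.suc v) = decodeAll (proj₂ (decode ts)) v

  decodeAll-encodeAll : ∀ {m} (bs : Fin m → B) rest v → decodeAll (encodeAll bs ++ rest) v ≡ bs v
  decodeAll-encodeAll {suc m} bs rest = go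
    where
      head-decoded : decode (encodeAll bs ++ rest) ≡ (bs Fin.zero , encodeAll (bs ∘ Fin.suc) ++ rest)
      head-decoded = trans (cong decode (++-assoc (encode (bs Fin.zero)) _ rest)) (decode-encode _ _)

      go : ∀ v → decodeAll (encodeAll bs ++ rest) v ≡ bs v
      go Fin.zero    = cong proj₁ head-decoded
      go (Fin.suc w) = trans (cong (λ p → decodeAll (proj₂ p) w) head-decoded)
                             (decodeAll-encodeAll (bs ∘ Fin.suc) rest w)

  length-encodeAll : ∀ {m} (bs : Fin m → B) → length (encodeAll bs) ≡ ∑[ v < m ] length (encode (bs v))
  length-encodeAll {zero}  bs = refl
  length-encodeAll {suc m} bs =
    trans (length-++ (encode (bs Fin.zero))) (cong (length (encode (bs Fin.zero)) +_) (length-encodeAll (bs ∘ Fin.suc)))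

words : (T M : ℕ) → List (Vec (Fin T) M)
words T M = map (Vec.tabulate ∘ finToFun) (allFin (T ^ M))

length-words : ∀ T M → length (words T M) ≡ T ^ M
length-words T M = trans (length-map _ (allFin (T ^ M))) (length-tabulate id)

∈-words : ∀ {T M} (w : Vec (Fin T) M) → w ∈ words T M
∈-words w = subst (_∈ words _ _) (trans (Vec.tabulate-cong (finToFun-funToFin (Vec.lookup w))) (Vec.tabulate∘lookup w))
                  (∈-map⁺ _ (∈-allFin (funToFin (Vec.lookup w))))

padTo : ∀ {A : Set} {M} → A → (xs : List A) → length xs ≤ M → Vec A M
padTo {M = M} a []       _       = Vec.replicate M a
padTo         a (x ∷ xs) (s≤s p) = x Vec.∷ padTo a xs p

toList-padTo : ∀ {A : Set} {M} a (xs : List A) (p : length xs ≤ M) → ∃ λ rest → Vec.toList (padTo a xs p) ≡ xs ++ rest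
toList-padTo a []       _       = _ , refl
toList-padTo a (x ∷ xs) (s≤s p) = map₂ (cong (x ∷_)) (toList-padTo a xs p)

n<2^suc⌊log₂n⌋ : ∀ n → n < 2 ^ suc ⌊log₂ n ⌋
n<2^suc⌊log₂n⌋ n = ≰⇒> λ 2^≤n → <-irrefl refl (subst (_≤ ⌊log₂ n ⌋) (⌊log₂[2^n]⌋≡n _) (⌊log₂⌋-mono-≤ 2^≤n))

finToFun-injective : ∀ {m n} {x y : Fin (m ^ n)} → finToFun {m} {n} x ≗ finToFun y → x ≡ y
finToFun-injective {m} {n} {x} {y} eq =
  trans (sym (funToFin-finToFin {n} {m} x)) (trans (funToFin-cong eq) (funToFin-finToFin {n} {m} y))
  where
    funToFin-cong : ∀ {m n} {f g : Fin m → Fin n} → f ≗ g → funToFin f ≡ funToFin g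
    funToFin-cong {zero}  eq = refl
    funToFin-cong {suc m} eq = cong₂ Fin.combine (eq Fin.zero) (funToFin-cong (eq ∘ Fin.suc))

module BinaryDigits {k L : ℕ} (k≤2^L : k ≤ 2 ^ L) where

  open Inverse 2↔Bool using (strictlyInverseʳ) renaming (to to toBool; from to fromBool)

  digit : Fin L → Fin k → Bool
  digit c i = toBool (finToFun (Fin.inject≤ i k≤2^L) c)

  digits-separate : ∀ {i i′} → (∀ c → digit c i ≡ digit c i′) → i ≡ i′
  digits-separate {i} {i′} eq =
    inject≤-injective k≤2^L k≤2^L i i′ (finToFun-injective {2} {L} (toBool-injective ∘ eq))
    where
      toBool-injective : ∀ {a b} → toBool a ≡ toBool b → a ≡ b
      toBool-injective {a} {b} e = trans (sym (strictlyInverseʳ a)) (trans (cong fromBool e) (strictlyInverseʳ b))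

∑-mono-≤ : ∀ {m} {f g : Fin m → ℕ} → (∀ v → f v ≤ g v) → sum f ≤ sum g
∑-mono-≤ {zero}  f≤g = z≤n
∑-mono-≤ {suc m} f≤g = +-mono-≤ (f≤g Fin.zero) (∑-mono-≤ (f≤g ∘ Fin.suc))

∑-const-1 : ∀ m → ∑[ v < m ] 1 ≡ m
∑-const-1 zero    = refl
∑-const-1 (suc m) = cong suc (∑-const-1 m)

∑-indicator : ∀ {m} (u : Fin m) → ∑[ v < m ] (if does (u Fin.≟ v) then 1 else 0) ≡ 1
∑-indicator {suc m} Fin.zero    = cong suc (sum-replicate-zero m)
∑-indicator {suc m} (Fin.suc u) = ∑-indicator u

fibre : ∀ {A : Set} {m} → (A → Fin m) → List A → Fin m → List A
fibre f xs v = filter (λ x → f x Fin.≟ v) xs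

∑-length-fibre : ∀ {A : Set} {m} (f : A → Fin m) xs → ∑[ v < m ] length (fibre f xs v) ≡ length xs
∑-length-fibre {m = m} f []       = sum-replicate-zero m
∑-length-fibre {m = m} f (x ∷ xs) = begin
  ∑[ v < m ] length (fibre f (x ∷ xs) v)               ≡⟨ sum-cong-≗ length-fibre-∷ ⟩
  ∑[ v < m ] (hit v + length (fibre f xs v))           ≡⟨ ∑-distrib-+ hit _ ⟩
  ∑[ v < m ] hit v + ∑[ v < m ] length (fibre f xs v)  ≡⟨ cong₂ _+_ (∑-indicator (f x)) (∑-length-fibre f xs) ⟩
  suc (length xs)                                       ∎
  where
    open ≡-Reasoning

    hit : Fin m → ℕ
    hit v = if does (f x Fin.≟ v) then 1 else 0

    length-fibre-∷ : ∀ v → length (fibre f (x ∷ xs) v) ≡ hit v + length (fibre f xs v)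
    length-fibre-∷ v with does (f x Fin.≟ v)
    ... | true  = refl
    ... | false = refl

offset : ∀ {m} → (Fin m → ℕ) → Fin m → ℕ
offset f Fin.zero    = 0
offset f (Fin.suc v) = f Fin.zero + offset (f ∘ Fin.suc) v

offset+≤∑ : ∀ {m} (f : Fin m → ℕ) v → offset f v + f v ≤ sum f
offset+≤∑ f Fin.zero    = m≤m+n _ _
offset+≤∑ f (Fin.suc v) = ≤-trans (≤-reflexive (+-assoc (f Fin.zero) _ _)) (+-monoʳ-≤ (f Fin.zero) (offset+≤∑ (f ∘ Fin.suc) v))

offset-disjoint : ∀ {m} (f : Fin m → ℕ) {v w a b} → a < f v → b < f w → offset f v + a ≡ offset f w + b → v ≡ w
offset-disjoint f {Fin.zero}  {Fin.zero}  a< b< eq = refl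
offset-disjoint f {Fin.zero}  {Fin.suc w} a< b< eq = ⊥-elim (<⇒≱ a< (≤-trans (≤-trans (m≤m+n _ _) (m≤m+n _ _)) (≤-reflexive (sym eq))))
offset-disjoint f {Fin.suc v} {Fin.zero}  a< b< eq = ⊥-elim (<⇒≱ b< (≤-trans (≤-trans (m≤m+n _ _) (m≤m+n _ _)) (≤-reflexive eq)))
offset-disjoint f {Fin.suc v} {Fin.suc w} a< b< eq = cong Fin.suc (offset-disjoint (f ∘ Fin.suc) a< b<
  (+-cancelˡ-≡ (f Fin.zero) _ _ (trans (sym (+-assoc (f Fin.zero) _ _)) (trans eq (+-assoc (f Fin.zero) _ _)))))

module IntervalColouring {k L : ℕ} (test : Fin L → Fin k → Bool) where

  open Splitting test

  size : Maybe (Trie L) → ℕ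
  size nothing  = 0
  size (just t) = leaves t

  -- Truncation at k only makes colourings total: it is applied to values below k (colour-full).
  clamp : ℕ → Fin (suc k)
  clamp n = Fin.fromℕ< (s≤s (m⊓n≤n n k))

  colourIn : Maybe (Trie L) → ℕ → Fin k → Fin (suc k)
  colourIn nothing  base i = Fin.fromℕ k
  colourIn (just t) base i = clamp (base + slot t i)

  colouring : (Fin k → Maybe (Trie L)) → Fin k → Fin k → Fin (suc k)
  colouring cs i j = colourIn (cs j) (offset (size ∘ cs) j) i

  SeparatesFibres : (Fin k → Fin k) → (Fin k → Maybe (Trie L)) → Set
  SeparatesFibres δ cs =
    ∀ i → Σ (Trie L) λ t → cs (δ i) ≡ just t × (∀ i′ → δ i′ ≡ δ i → slot t i′ ≡ slot t i → i′ ≡ i)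

  module _ (cs : Fin k → Maybe (Trie L)) (budget : sum (size ∘ cs) ≤ k) where

    slot<size : ∀ {j t} i → cs j ≡ just t → slot t i < size (cs j)
    slot<size {t = t} i e = subst (slot t i <_) (cong size (sym e)) (slot<leaves t i)

    colour-empty : ∀ {j} i → cs j ≡ nothing → toℕ (colouring cs i j) ≡ k
    colour-empty {j} i e rewrite e = toℕ-fromℕ k

    colour-in-interval : ∀ {j t} i → cs j ≡ just t → offset (size ∘ cs) j + slot t i < k
    colour-in-interval {j} i e = <-≤-trans (+-monoʳ-< _ (slot<size i e)) (≤-trans (offset+≤∑ (size ∘ cs) j) budget)

    colour-full : ∀ {j t} i → cs j ≡ just t → toℕ (colouring cs i j) ≡ offset (size ∘ cs) j + slot t i
    colour-full {j} i e rewrite e = trans (toℕ-fromℕ< _) (m≤n⇒m⊓n≡m (<⇒≤ (colour-in-interval i e)))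

    same-colour⇒same-column : ∀ {i i′ j j′ t t′} → cs j ≡ just t → cs j′ ≡ just t′ →
                              colouring cs i j ≡ colouring cs i′ j′ → j ≡ j′
    same-colour⇒same-column {i} {i′} e e′ eq = offset-disjoint (size ∘ cs) (slot<size i e) (slot<size i′ e′)
      (trans (sym (colour-full i e)) (trans (cong toℕ eq) (colour-full i′ e′)))

    same-colour⇒same-slot : ∀ {i i′ j t} → cs j ≡ just t → colouring cs i j ≡ colouring cs i′ j → slot t i ≡ slot t i′
    same-colour⇒same-slot {i} {i′} e eq =
      +-cancelˡ-≡ _ _ _ (trans (sym (colour-full i e)) (trans (cong toℕ eq) (colour-full i′ e)))

    empty≢full : ∀ {i i′ j j′ t} → cs j ≡ nothing → cs j′ ≡ just t → colouring cs i j ≢ colouring cs i′ j′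
    empty≢full {i} {i′} e e′ eq =
      <⇒≢ (colour-in-interval i′ e′) (trans (sym (colour-full i′ e′)) (trans (cong toℕ (sym eq)) (colour-empty i e)))

    module _ (δ : Fin k → Fin k) (separated : SeparatesFibres δ cs) where

      clique-proper : ∀ {i i′} → i ≢ i′ → colouring cs i (δ i) ≢ colouring cs i′ (δ i′)
      clique-proper {i} {i′} i≢i′ eq with separated i | separated i′
      ... | t , e , separates | _ , e′ , _ = i≢i′ (sym (separates i′ (sym δi≡δi′) (sym (same-colour⇒same-slot e eq′))))
        where
          δi≡δi′ : δ i ≡ δ i′
          δi≡δi′ = same-colour⇒same-column e e′ eq

          eq′ : colouring cs i (δ i) ≡ colouring cs i′ (δ i)
          eq′ = subst (λ j → colouring cs i (δ i) ≡ colouring cs i′ j) (sym δi≡δi′) eq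

      row-proper : ∀ {i j} → j ≢ δ i → colouring cs i (δ i) ≢ colouring cs i j
      row-proper {i} {j} j≢δi with separated i
      ... | _ , e , _ = by-column (cs j) refl
        where
          by-column : ∀ c → cs j ≡ c → colouring cs i (δ i) ≢ colouring cs i j
          by-column nothing  e′ eq = empty≢full e′ e (sym eq)
          by-column (just _) e′ eq = j≢δi (sym (same-colour⇒same-column e e′ eq))

      colouring-proper : ProperColoring δ (colouring cs)
      colouring-proper i _ i′ _ (inj₁ (refl , refl , i≢i′))         = clique-proper i≢i′
      colouring-proper i _ _  _ (inj₂ (refl , inj₁ (refl , j′≢δi))) = row-proper j′≢δi
      colouring-proper i _ _  _ (inj₂ (refl , inj₂ (refl , j≢δi)))  = row-proper j≢δi ∘ sym

3+n≤2^[3*⌊log₂n⌋] : ∀ n → 2 ≤ n → 3 + n ≤ 2 ^ (3 * ⌊log₂ n ⌋)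
3+n≤2^[3*⌊log₂n⌋] n 2≤n = begin
  2 + suc n               ≤⟨ +-mono-≤ (^-monoʳ-≤ 2 {1} {suc q} (s≤s z≤n)) (n<2^suc⌊log₂n⌋ n) ⟩
  2 ^ suc q + 2 ^ suc q   ≡⟨ cong (2 ^ suc q +_) (+-identityʳ _) ⟨
  2 ^ (2 + q)             ≤⟨ ^-monoʳ-≤ 2 (≤-trans (≤-reflexive (+-comm 2 q)) (+-monoʳ-≤ q (*-monoʳ-≤ 2 1≤q))) ⟩
  2 ^ (3 * q)             ∎
  where
    open ≤-Reasoning

    q : ℕ
    q = ⌊log₂ n ⌋

    1≤q : 1 ≤ q
    1≤q = ⌊log₂⌋-mono-≤ 2≤n

[3+⌊log₂k⌋]^3k≤2^[9k⌊log₂⌊log₂k⌋⌋] : ∀ k → 4 ≤ k → (3 + ⌊log₂ k ⌋) ^ (3 * k) ≤ 2 ^ (9 * k * ⌊log₂ ⌊log₂ k ⌋ ⌋)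
[3+⌊log₂k⌋]^3k≤2^[9k⌊log₂⌊log₂k⌋⌋] k 4≤k = begin
  (3 + ⌊log₂ k ⌋) ^ (3 * k)  ≤⟨ ^-monoˡ-≤ (3 * k) (3+n≤2^[3*⌊log₂n⌋] ⌊log₂ k ⌋ (⌊log₂⌋-mono-≤ 4≤k)) ⟩
  (2 ^ (3 * q)) ^ (3 * k)    ≡⟨ ^-*-assoc 2 (3 * q) (3 * k) ⟩
  2 ^ (3 * q * (3 * k))      ≡⟨ cong (2 ^_) (exponent q k) ⟩
  2 ^ (9 * k * q)            ∎
  where
    open ≤-Reasoning

    q : ℕ
    q = ⌊log₂ ⌊log₂ k ⌋ ⌋

    exponent : ∀ q k → 3 * q * (3 * k) ≡ 9 * k * q
    exponent = solve-∀

module Construction (k : ℕ) where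

  L : ℕ
  L = suc ⌊log₂ k ⌋

  open BinaryDigits {k} {L} (<⇒≤ (n<2^suc⌊log₂n⌋ k))
  open Splitting digit
  open IntervalColouring digit
  open Concatenation (encodeColumn {L}) decodeColumn decodeColumn-encodeColumn

  trieOf : List (Fin k) → Maybe (Trie L)
  trieOf []       = nothing
  trieOf (i ∷ is) = just (build (allFin L) (i ∷ is))

  trieOf-∈ : ∀ {i is} → i ∈ is → trieOf is ≡ just (build (allFin L) is)
  trieOf-∈ {is = _ ∷ _} _ = refl

  size-trieOf : ∀ is → size (trieOf is) ≤ length is
  size-trieOf []       = z≤n
  size-trieOf (i ∷ is) = leaves-build (allFin L) i is

  length-encodeColumn-trieOf : ∀ is → length (encodeColumn (trieOf is)) ≤ 2 * length is + 1
  length-encodeColumn-trieOf []       = ≤-refl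
  length-encodeColumn-trieOf (i ∷ is) = begin
    length (serialise t)        ≤⟨ n≤1+n _ ⟩
    suc (length (serialise t))  ≡⟨ length-serialise t ⟩
    2 * leaves t                ≤⟨ *-monoʳ-≤ 2 (leaves-build (allFin L) i is) ⟩
    2 * length (i ∷ is)         ≤⟨ m≤m+n _ 1 ⟩
    2 * length (i ∷ is) + 1     ∎
    where
      open ≤-Reasoning

      t : Trie L
      t = build (allFin L) (i ∷ is)

  rows : (Fin k → Fin k) → Fin k → List (Fin k)
  rows δ = fibre δ (allFin k)

  ∈-rows : ∀ δ i → i ∈ rows δ (δ i)
  ∈-rows δ i = ∈-filter⁺ (λ i′ → δ i′ Fin.≟ δ i) (∈-allFin i) refl

  ∑-length-rows : ∀ δ → ∑[ v < k ] length (rows δ v) ≡ k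
  ∑-length-rows δ = trans (∑-length-fibre δ (allFin k)) (length-tabulate id)

  fibreTries : (Fin k → Fin k) → Fin k → Maybe (Trie L)
  fibreTries δ v = trieOf (rows δ v)

  fibreTries-separate : ∀ δ → SeparatesFibres δ (fibreTries δ)
  fibreTries-separate δ i = build (allFin L) (rows δ (δ i)) , trieOf-∈ (∈-rows δ i) , λ i′ δi′≡δi eq →
    digits-separate λ c → build-separates (allFin L) (rows δ (δ i))
      (subst (λ v → i′ ∈ rows δ v) δi′≡δi (∈-rows δ i′)) (∈-rows δ i) eq (∈-allFin c)

  fibreTries-budget : ∀ δ → sum (size ∘ fibreTries δ) ≤ k
  fibreTries-budget δ = ≤-trans (∑-mono-≤ (λ v → size-trieOf (rows δ v))) (≤-reflexive (∑-length-rows δ))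

  length-encodeAll-fibreTries : ∀ δ → length (encodeAll (fibreTries δ)) ≤ 3 * k
  length-encodeAll-fibreTries δ = begin
    length (encodeAll (fibreTries δ))                  ≡⟨ length-encodeAll (fibreTries δ) ⟩
    ∑[ v < k ] length (encodeColumn (fibreTries δ v))  ≤⟨ ∑-mono-≤ (length-encodeColumn-trieOf ∘ rows δ) ⟩
    ∑[ v < k ] (2 * length (rows δ v) + 1)             ≡⟨ ∑-distrib-+ (λ v → 2 * length (rows δ v)) (λ _ → 1) ⟩
    ∑[ v < k ] (2 * length (rows δ v)) + ∑[ v < k ] 1  ≡⟨ cong₂ _+_ (sym (*-distribˡ-sum 2 (length ∘ rows δ)))
                                                                     (∑-const-1 k) ⟩
    2 * ∑[ v < k ] length (rows δ v) + k               ≡⟨ cong (λ n → 2 * n + k) (∑-length-rows δ) ⟩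
    2 * k + k                                          ≡⟨ +-comm (2 * k) k ⟩
    3 * k                                              ∎
    where open ≤-Reasoning

  family : List (Fin k → Fin k → Fin (suc k))
  family = map (colouring ∘ decodeAll ∘ Vec.toList) (words (2 + L) (3 * k))

  length-family : length family ≡ (3 + ⌊log₂ k ⌋) ^ (3 * k)
  length-family = trans (length-map _ (words (2 + L) (3 * k))) (length-words (2 + L) (3 * k))

  family-covers : IsColoringFamily k family
  family-covers δ = colouring cs , ∈-map⁺ _ (∈-words w) , colouring-proper cs budget δ separating
    where
      w : Vec (Token L) (3 * k)
      w = padTo leaf-token (encodeAll (fibreTries δ)) (length-encodeAll-fibreTries δ)

      cs : Fin k → Maybe (Trie L)
      cs = decodeAll (Vec.toList w)

      decoded : cs ≗ fibreTries δ
      decoded v with rest , eq ← toList-padTo leaf-token (encodeAll (fibreTries δ)) (length-encodeAll-fibreTries δ)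
        = trans (cong (λ ts → decodeAll ts v) eq) (decodeAll-encodeAll (fibreTries δ) rest v)

      budget : sum (size ∘ cs) ≤ k
      budget = subst (_≤ k) (sum-cong-≗ (cong size ∘ sym ∘ decoded)) (fibreTries-budget δ)

      separating : SeparatesFibres δ cs
      separating i with t , e , separates ← fibreTries-separate δ i = t , trans (decoded (δ i)) e , separates

lemma8 : Σ ℕ (λ C → Σ ℕ (λ k₀ → (k : ℕ) → k₀ ≤ k →
           Σ (List (Fin k → Fin k → Fin (ℕ.suc k))) (λ F →
             IsColoringFamily k F × (length F ≤ 2 ^ (C * k * ⌊log₂ ⌊log₂ k ⌋ ⌋)))))
lemma8 = 9 , 4 , λ k 4≤k → family k , family-covers k ,
  ≤-trans (≤-reflexive (length-family k)) ([3+⌊log₂k⌋]^3k≤2^[9k⌊log₂⌊log₂k⌋⌋] k 4≤k)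
  where open Construction
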